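{- Let $n\in\mathbb{N}$, let $\dot C_t$ be a colored chain on $t$ vertices and let $\alpha=\alpha(\dot C_t)$. Then $$\tilde{R}(\dot C^{(rbr)}_{\alpha},Q_n)\le \tilde{R}(\dot C_t,Q_n)\le \tilde{R}(\dot C^{(rbr)}_{\alpha},Q_n)+t-\alpha.$$
   Context: $Q_N$ denotes the Boolean lattice of all subsets of an $N$-element set ordered by inclusion. An (induced) copy of a poset $P$ in a poset $Q$ is a subset of $Q$ which, with the inherited order, is isomorphic to $P$. A colored poset $\dot P$ is a poset with a coloring of its elements in blue and red; a copy of $\dot P$ in a colored $Q$ is an induced copy of $P$ whose vertices have the same colors as the corresponding vertices of $\dot P$. $\dot Q_n^{(b)}$ (resp. $\dot Q_n^{(r)}$) is $Q_n$ colored entirely blue (resp. red). $\tilde{R}(\dot P,Q_n)$ is the minimum $N$ such that every blue/red coloring of $Q_N$ contains a copy of $\dot P$, of $\dot Q_n^{(b)}$, or of $\dot Q_n^{(r)}$. A chain $C_a$ is a poset on $a$ pairwise comparable vertices. The red-alternating chain $\dot C_a^{(rbr)}$ is $C_a$ with vertices colored alternately red and blue along the chain, the minimal vertex being red; the blue-alternating chain $\dot C_a^{(brb)}$ is defined analogously with blue minimal vertex. For a colored chain $\dot C$, $\alpha(\dot C)$ is the maximum $a$ such that $\dot C$ contains a copy of $\dot C_a^{(rbr)}$ or of $\dot C_a^{(brb)}$. -}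

module Defs where

open import Data.Nat using (ℕ; zero; suc; _≤_)
open import Data.Fin using (Fin; toℕ)
import Data.Fin as F
open import Data.Fin.Subset using (Subset; _⊆_)
open import Data.Product using (_×_; Σ)
open import Data.Sum using (_⊎_)
open import Relation.Binary.PropositionalEquality using (_≡_)

data Color : Set where
  blue red : Color

flipColor : Color → Color
flipColor blue = red
flipColor red  = blue

-- A colored chain on t vertices: the chain C_t is Fin t with its natural
-- order (vertex 0 minimal), and the coloring is a function Fin t → Color.
ColoredChain : ℕ → Set
ColoredChain t = Fin t → Color

alt : Color → ℕ → Color
alt c zero    = c
alt c (suc i) = alt (flipColor c) i

rbr : (a : ℕ) → ColoredChain a
rbr a i = alt red (toℕ i)

brb : (a : ℕ) → ColoredChain a
brb a i = alt blue (toℕ i)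

Coloring : ℕ → Set
Coloring N = Subset N → Color

ChainInChain : {a t : ℕ} → ColoredChain a → ColoredChain t → Set
ChainInChain {a} {t} c d =
  Σ (Fin a → Fin t) λ f →
    (∀ i j → (i F.≤ j → f i F.≤ f j) × (f i F.≤ f j → i F.≤ j))
    × (∀ i → d (f i) ≡ c i)

ContainsAlt : {t : ℕ} → ColoredChain t → ℕ → Set
ContainsAlt d a = ChainInChain (rbr a) d ⊎ ChainInChain (brb a) d

IsAlpha : {t : ℕ} → ColoredChain t → ℕ → Set
IsAlpha d a = ContainsAlt d a × (∀ b → ContainsAlt d b → b ≤ a)

-- A copy of the colored chain c in Q_N colored by col: an induced copy
-- (order embedding into (Subset N, ⊆)) with matching colors.
ChainCopy : {t : ℕ} → ColoredChain t → (N : ℕ) → Coloring N → Set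
ChainCopy {t} c N col =
  Σ (Fin t → Subset N) λ f →
    (∀ i j → (i F.≤ j → f i ⊆ f j) × (f i ⊆ f j → i F.≤ j))
    × (∀ i → col (f i) ≡ c i)

-- A copy of Q_n in Q_N all of whose vertices have color k (an induced copy,
-- i.e. an order embedding of (Subset n, ⊆) into (Subset N, ⊆)).
MonoCubeCopy : (n N : ℕ) → Coloring N → Color → Set
MonoCubeCopy n N col k =
  Σ (Subset n → Subset N) λ g →
    (∀ A B → (A ⊆ B → g A ⊆ g B) × (g A ⊆ g B → A ⊆ B))
    × (∀ A → col (g A) ≡ k)

Arrows : {t : ℕ} → ColoredChain t → ℕ → ℕ → Set
Arrows c n N = (col : Coloring N) →
  ChainCopy c N col ⊎ MonoCubeCopy n N col blue ⊎ MonoCubeCopy n N col red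

IsRamsey : {t : ℕ} → ColoredChain t → ℕ → ℕ → Set
IsRamsey c n R = Arrows c n R × (∀ N → Arrows c n N → R ≤ N)

-- If it has t vertices and consists of
-- b maximal monochromatic blocks, it arises from the alternating chain on b vertices (starting with
-- the colour of its bottom vertex) by t − b duplications of a vertex, and b is exactly α(Ċ): the
-- alternating chain formed by one vertex of each block is contained in Ċ, and an alternating subchain
-- meets every block at most once. The lower bound holds because a copy of Ċ contains a copy of an
-- alternating chain on α vertices, and swapping the two colours turns a blue-alternating chain into
-- a red-alternating one. The upper bound follows once duplicating a vertex is shown to cost at most
-- one dimension of the Boolean lattice.

module Submission where

open import Defs
open import Data.Nat using (ℕ; zero; suc; _≤_; _+_; _∸_; z≤n; s≤s)
open import Data.Nat.Properties
  using ( ≤-refl; ≤-trans; ≤-antisym; ≤-pred; m≤m+n; +-monoˡ-≤; +-assoc; +-suc; +-comm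
        ; m+n∸n≡m; <⇒≤; <⇒≱)
open import Data.Fin using (Fin; toℕ; punchOut)
import Data.Fin as F
open import Data.Fin.Properties using (punchOut-mono-≤; punchOut-cancel-≤; punchIn-punchOut)
open import Data.List using (List; []; _∷_; _++_; [_]; map; tabulate; length)
open import Data.List.Properties using (map-tabulate; tabulate-cong; length-tabulate; ++-assoc)
open import Data.List.Relation.Binary.Sublist.Propositional using ([]; _∷ʳ_; _∷_; minimum)
  renaming (_⊆_ to _⊑_; ⊆-refl to ⊑-refl; ⊆-trans to ⊑-trans)
open import Data.List.Relation.Binary.Sublist.Propositional.Properties using (++⁺)
open import Data.List.Relation.Unary.All as All using (All; []; _∷_)
open import Data.List.Relation.Unary.All.Properties as All using ()
open import Data.List.Relation.Unary.AllPairs as AllPairs using (AllPairs; []; _∷_)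
open import Data.List.Relation.Unary.AllPairs.Properties as AllPairs using ()
open import Data.List.Relation.Binary.Pointwise as Pointwise using (Pointwise; []; _∷_)
open import Data.Fin.Subset using (Subset; _⊆_; _⊂_; inside; outside)
open import Data.Fin.Subset.Properties
  using ( ⊆-refl; ⊆-trans; _⊆?_; _∈?_; _⊂?_; ⊂-irref; ⊂-⊆-trans; ⊆-⊂-trans; s⊆s; out⊆; drop-∷-⊆
        ; s⊂s; out⊂in; anySubset?)
open import Data.Vec using (_∷_)
open import Data.Vec.Functional using () renaming (_∷_ to _◂_)
open import Data.Product using (Σ; ∃; _×_; _,_; proj₁; proj₂)
open import Data.Sum using (_⊎_; inj₁; inj₂)
import Data.Sum as Sum
open import Data.Empty using (⊥-elim)
open import Function using (_∘_)
open import Relation.Nullary using (¬_; Dec; yes; no; does)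
open import Relation.Nullary.Decidable using (map′; decidable-stable; _×-dec_)
open import Relation.Unary using (U)
open import Relation.Binary.Definitions using (DecidableEquality)
open import Relation.Binary.PropositionalEquality
  using (_≡_; _≢_; refl; sym; trans; cong; subst)

flipColor-involutive : ∀ k → flipColor (flipColor k) ≡ k
flipColor-involutive blue = refl
flipColor-involutive red  = refl

flipColor-swap : ∀ {a b} → flipColor a ≡ b → a ≡ flipColor b
flipColor-swap {a} eq = trans (sym (flipColor-involutive a)) (cong flipColor eq)

alt-flipColor : ∀ k i → alt (flipColor k) i ≡ flipColor (alt k i)
alt-flipColor k zero    = refl
alt-flipColor k (suc i) = alt-flipColor (flipColor k) i

alternating : Color → ℕ → List Color
alternating k a = tabulate {n = a} (λ i → alt k (toℕ i))

map-flipColor-alternating : ∀ k a → map flipColor (alternating k a) ≡ alternating (flipColor k) a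
map-flipColor-alternating k a =
  trans (map-tabulate (λ i → alt k (toℕ i)) flipColor)
        (tabulate-cong (λ i → sym (alt-flipColor k (toℕ i))))

change : Color → Color → ℕ
change blue blue = 0
change red  red  = 0
change blue red  = 1
change red  blue = 1

changes : Color → List Color → ℕ
changes k []       = 0
changes k (x ∷ xs) = change k x + changes x xs

change≤1 : ∀ k x → change k x ≤ 1
change≤1 blue blue = z≤n
change≤1 red  red  = z≤n
change≤1 blue red  = ≤-refl
change≤1 red  blue = ≤-refl

change-triangle : ∀ k y x → change k x ≤ change k y + change y x
change-triangle blue blue x = ≤-refl
change-triangle red  red  x = ≤-refl
change-triangle blue red  x = ≤-trans (change≤1 blue x) (m≤m+n 1 (change red x))
change-triangle red  blue x = ≤-trans (change≤1 red x) (m≤m+n 1 (change blue x))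

changes-triangle : ∀ k y xs → changes k xs ≤ change k y + changes y xs
changes-triangle k y []       = z≤n
changes-triangle k y (x ∷ xs) = begin
  change k x + changes x xs                ≤⟨ +-monoˡ-≤ (changes x xs) (change-triangle k y x) ⟩
  (change k y + change y x) + changes x xs ≡⟨ +-assoc (change k y) (change y x) (changes x xs) ⟩
  change k y + (change y x + changes x xs) ∎
  where open Data.Nat.Properties.≤-Reasoning

-- flipColor k is a virtual predecessor: the first vertex of the alternating chain counts as a change.
alternating-⊑⇒≤changes : ∀ {k a xs} → alternating k a ⊑ xs → a ≤ changes (flipColor k) xs
alternating-⊑⇒≤changes {a = zero} _ = z≤n
alternating-⊑⇒≤changes {k} {suc a} {y ∷ ys} (_ ∷ʳ p) =
  ≤-trans (alternating-⊑⇒≤changes p) (changes-triangle (flipColor k) y ys)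
alternating-⊑⇒≤changes {blue} {suc a} (refl ∷ p) = s≤s (alternating-⊑⇒≤changes p)
alternating-⊑⇒≤changes {red}  {suc a} (refl ∷ p) = s≤s (alternating-⊑⇒≤changes p)

OrderEmbedding : ∀ {a} {B : Set} (_≼_ : B → B → Set) → (Fin a → B) → Set
OrderEmbedding _≼_ f = ∀ i j → (i F.≤ j → f i ≼ f j) × (f i ≼ f j → i F.≤ j)

module _ {B : Set} {_≼_ : B → B → Set} where

  embedding-◂ : ∀ {a} {b : B} {f : Fin a → B} →
                b ≼ b → (∀ j → b ≼ f j) → (∀ i → ¬ f i ≼ b) →
                OrderEmbedding _≼_ f → OrderEmbedding _≼_ (b ◂ f)
  embedding-◂ b≼b b≼f f⋠b e F.zero    F.zero    = (λ _ → b≼b) , (λ _ → z≤n)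
  embedding-◂ b≼b b≼f f⋠b e F.zero    (F.suc j) = (λ _ → b≼f j) , (λ _ → z≤n)
  embedding-◂ b≼b b≼f f⋠b e (F.suc i) F.zero    = (λ ()) , (λ fi≼b → ⊥-elim (f⋠b i fi≼b))
  embedding-◂ b≼b b≼f f⋠b e (F.suc i) (F.suc j) =
    (λ { (s≤s i≤j) → proj₁ (e i j) i≤j }) , (λ fi≼fj → s≤s (proj₂ (e i j) fi≼fj))

embedding-∘ : ∀ {a b} {B : Set} {_≼_ : B → B → Set} {g : Fin a → Fin b} {f : Fin b → B} →
              OrderEmbedding F._≤_ g → OrderEmbedding _≼_ f → OrderEmbedding _≼_ (f ∘ g)
embedding-∘ {g = g} eg ef i j =
  proj₁ (ef (g i) (g j)) ∘ proj₁ (eg i j) , proj₂ (eg i j) ∘ proj₂ (ef (g i) (g j))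

embedding-suc : ∀ {a t} {g : Fin a → Fin t} →
                OrderEmbedding F._≤_ g → OrderEmbedding F._≤_ (F.suc ∘ g)
embedding-suc e i j =
  (λ i≤j → s≤s (proj₁ (e i j) i≤j)) , (λ { (s≤s gi≤gj) → proj₂ (e i j) gi≤gj })

embedding-punchOut : ∀ {a t} {f : Fin a → Fin (suc t)} (nz : ∀ i → F.zero ≢ f i) →
                     OrderEmbedding F._≤_ f → OrderEmbedding F._≤_ (λ i → punchOut (nz i))
embedding-punchOut nz e i j =
  (λ i≤j → punchOut-mono-≤ (nz i) (nz j) (proj₁ (e i j) i≤j)) ,
  (λ le → proj₂ (e i j) (punchOut-cancel-≤ (nz i) (nz j) le))

embedding-∘suc : ∀ {a} {B : Set} {_≼_ : B → B → Set} {f : Fin (suc a) → B} →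
                 OrderEmbedding _≼_ f → OrderEmbedding _≼_ (f ∘ F.suc)
embedding-∘suc e i j = (λ i≤j → proj₁ (e (F.suc i) (F.suc j)) (s≤s i≤j)) ,
                       (λ fi≼fj → ≤-pred (proj₂ (e (F.suc i) (F.suc j)) fi≼fj))

embedding-suc-nonzero : ∀ {a t} {f : Fin (suc a) → Fin (suc t)} → OrderEmbedding F._≤_ f →
                        ∀ i → F.zero ≢ f (F.suc i)
embedding-suc-nonzero {f = f} e i 0≡fi with proj₂ (e (F.suc i) F.zero) (subst (F._≤ f F.zero) 0≡fi z≤n)
... | ()

module _ {A : Set} where

  embedding⇒tabulate-⊑ : ∀ {a t} {c : Fin a → A} {d : Fin t → A} (f : Fin a → Fin t) →
    OrderEmbedding F._≤_ f → (∀ i → d (f i) ≡ c i) → tabulate c ⊑ tabulate d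
  embedding⇒tabulate-⊑ {zero}              f e col = minimum _
  embedding⇒tabulate-⊑ {suc a} {zero}      f e col with f F.zero
  ... | ()
  embedding⇒tabulate-⊑ {suc a} {suc t} {c} {d} f e col = by-cases (f F.zero F.≟ F.zero)
    where
    below : ∀ {b} {c′ : Fin b → A} (g : Fin b → Fin (suc t)) (nz : ∀ i → F.zero ≢ g i) →
            OrderEmbedding F._≤_ g → (∀ i → d (g i) ≡ c′ i) → tabulate c′ ⊑ tabulate (d ∘ F.suc)
    below g nz eg colg = embedding⇒tabulate-⊑ (λ i → punchOut (nz i)) (embedding-punchOut nz eg)
                           (λ i → trans (cong d (punchIn-punchOut (nz i))) (colg i))
    by-cases : Dec (f F.zero ≡ F.zero) → tabulate c ⊑ tabulate d
    by-cases (yes f0≡0) = trans (sym (col F.zero)) (cong d f0≡0)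
      ∷ below (f ∘ F.suc) (embedding-suc-nonzero e) (embedding-∘suc {_≼_ = F._≤_} e) (col ∘ F.suc)
    by-cases (no f0≢0) = d F.zero ∷ʳ below f nonzero e col
      where
      nonzero : ∀ i → F.zero ≢ f i
      nonzero F.zero    = f0≢0 ∘ sym
      nonzero (F.suc i) = embedding-suc-nonzero e i

  tabulate-⊑⇒embedding : ∀ {a t} {c : Fin a → A} {d : Fin t → A} → tabulate c ⊑ tabulate d →
    Σ (Fin a → Fin t) λ f → OrderEmbedding F._≤_ f × (∀ i → d (f i) ≡ c i)
  tabulate-⊑⇒embedding {zero}          _ = (λ ()) , (λ ()) , (λ ())
  tabulate-⊑⇒embedding {suc a} {zero}  ()
  tabulate-⊑⇒embedding {suc a} {suc t} (_ ∷ʳ p) with tabulate-⊑⇒embedding p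
  ... | g , e , col = F.suc ∘ g , embedding-suc e , col
  tabulate-⊑⇒embedding {suc a} {suc t} (c0≡d0 ∷ p) with tabulate-⊑⇒embedding p
  ... | g , e , col =
    F.zero ◂ F.suc ∘ g ,
    embedding-◂ {_≼_ = F._≤_} z≤n (λ _ → z≤n) (λ _ ()) (embedding-suc e) ,
    λ { F.zero → sym c0≡d0 ; (F.suc i) → col i }

_≟_ : DecidableEquality Color
blue ≟ blue = yes refl
red  ≟ red  = yes refl
blue ≟ red  = no λ ()
red  ≟ blue = no λ ()

⊆∧⊈⇒⊂ : ∀ {N} {A B : Subset N} → A ⊆ B → ¬ B ⊆ A → A ⊂ B
⊆∧⊈⇒⊂ {A = A} {B} A⊆B B⊈A with A ⊂? B
... | yes A⊂B = A⊂B
... | no  A⊄B = ⊥-elim (B⊈A λ {x} x∈B →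
        decidable-stable (x ∈? A) (λ x∉A → A⊄B (A⊆B , x , x∈B , x∉A)))

module _ {N : ℕ} where

  Painted : Coloring N → Subset N → Color → Set
  Painted col A k = col A ≡ k

  -- Chains are listed from the bottom; the region P is what lets a chain be cut at a vertex
  -- and glued back together.
  record Chain (col : Coloring N) (P : Subset N → Set) (cs : List Color) : Set where
    constructor chain
    field
      elements : List (Subset N)
      strict   : AllPairs _⊂_ elements
      painted  : Pointwise (Painted col) elements cs
      within   : All P elements

  Copy : Coloring N → List Color → Set
  Copy col = Chain col U

module _ {N : ℕ} {col : Coloring N} where

  chain-weaken : ∀ {P Q : Subset N → Set} {cs} → (∀ {A} → P A → Q A) → Chain col P cs → Chain col Q cs
  chain-weaken P⇒Q (chain As s p w) = chain As s p (All.map P⇒Q w)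

  chain-∷⁺ : ∀ {P k ks} → (∃ λ A → P A × col A ≡ k × Chain col (λ X → P X × A ⊂ X) ks) →
             Chain col P (k ∷ ks)
  chain-∷⁺ (A , PA , colA , chain As s p w) =
    chain (A ∷ As) (All.map proj₂ w ∷ s) (colA ∷ p) (PA ∷ All.map proj₁ w)

  chain-∷⁻ : ∀ {P k ks} → Chain col P (k ∷ ks) →
             ∃ λ A → P A × col A ≡ k × Chain col (λ X → P X × A ⊂ X) ks
  chain-∷⁻ (chain (A ∷ As) (A⊂As ∷ s) (colA ∷ p) (PA ∷ w)) =
    A , PA , colA , chain As s p (All.zip (w , A⊂As))

  chain? : ∀ {P} → (∀ A → Dec (P A)) → ∀ cs → Dec (Chain col P cs)
  chain? P? []       = yes (chain [] [] [] [])
  chain? P? (k ∷ ks) = map′ chain-∷⁺ chain-∷⁻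
    (anySubset? λ A → P? A ×-dec (col A ≟ k) ×-dec chain? (λ X → P? X ×-dec (A ⊂? X)) ks)

  chain-split : ∀ {P} xs {x ys} → Chain col P (xs ++ x ∷ ys) →
    ∃ λ A → P A × col A ≡ x × Chain col (λ X → P X × X ⊆ A) (xs ++ [ x ])
                            × Chain col (λ X → P X × A ⊂ X) ys
  chain-split []       c with chain-∷⁻ c
  ... | A , PA , colA , above =
    A , PA , colA , chain-∷⁺ (A , (PA , ⊆-refl) , colA , chain [] [] [] []) , above
  chain-split (k ∷ xs) c with chain-∷⁻ c
  ... | B , PB , colB , rest with chain-split xs rest
  ... | A , (PA , B⊂A) , colA , below , above =
    A , PA , colA ,
    chain-∷⁺ (B , (PB , proj₁ B⊂A) , colB ,
              chain-weaken (λ ((PX , B⊂X) , X⊆A) → (PX , X⊆A) , B⊂X) below) ,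
    chain-weaken (λ ((PX , _) , A⊂X) → PX , A⊂X) above

  chain-recolour : ∀ {P cs} {col′ : Coloring N} → (∀ {A} → P A → col A ≡ col′ A) →
                   Chain col P cs → Chain col′ P cs
  chain-recolour {P} {col′ = col′} same (chain As s p w) = chain As s (repaint p w) w
    where
    repaint : ∀ {As cs} → Pointwise (Painted col) As cs → All P As → Pointwise (Painted col′) As cs
    repaint []         []        = []
    repaint (colA ∷ p) (PA ∷ w) = trans (sym (same PA)) colA ∷ repaint p w

  chain-++ : ∀ {P Q cs ds} → (∀ {X Y} → P X → Q Y → X ⊂ Y) →
             Chain col P cs → Chain col Q ds → Copy col (cs ++ ds)
  chain-++ P⊂Q (chain As s p w) (chain Bs s′ p′ w′) =
    chain (As ++ Bs) (AllPairs.++⁺ s s′ (All.map (λ PX → All.map (P⊂Q PX) w′) w))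
          (Pointwise.++⁺ p p′) (All.universal-U _)

chain-map : ∀ {M N} {col : Coloring N} {P : Subset M → Set} {Q : Subset N → Set} {cs}
  (h : Subset M → Subset N) → (∀ {X Y} → X ⊂ Y → h X ⊂ h Y) → (∀ {X} → P X → Q (h X)) →
  Chain (col ∘ h) P cs → Chain col Q cs
chain-map {col = col} h h-mono P⇒Q (chain As s p w) =
  chain (map h As) (AllPairs.map⁺ (AllPairs.map h-mono s)) (paint p) (All.map⁺ (All.map P⇒Q w))
  where
  paint : ∀ {As cs} → Pointwise (Painted (col ∘ h)) As cs → Pointwise (Painted col) (map h As) cs
  paint []         = []
  paint (colA ∷ p) = colA ∷ paint p

chainCopy⇒copy : ∀ {t N col} {c : ColoredChain t} → ChainCopy c N col → Copy col (tabulate c)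
chainCopy⇒copy (f , e , colf) =
  chain (tabulate f)
        (AllPairs.tabulate⁺-< λ {i} {j} i<j →
          ⊆∧⊈⇒⊂ (proj₁ (e i j) (<⇒≤ i<j)) (λ fj⊆fi → <⇒≱ i<j (proj₂ (e j i) fj⊆fi)))
        (Pointwise.tabulate⁺ colf) (All.universal-U _)

chain⇒chainCopy : ∀ {t N col P} {c : ColoredChain t} → Chain col P (tabulate c) →
  Σ (Fin t → Subset N) λ f → OrderEmbedding _⊆_ f × (∀ i → col (f i) ≡ c i) × (∀ i → P (f i))
chain⇒chainCopy {zero}  _ = (λ ()) , (λ ()) , (λ ()) , (λ ())
chain⇒chainCopy {suc t} c with chain-∷⁻ c
... | A , PA , colA , above with chain⇒chainCopy above
... | f , e , colf , Pf =
  A ◂ f ,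
  embedding-◂ {_≼_ = _⊆_} ⊆-refl (λ j → proj₁ (proj₂ (Pf j)))
              (λ i fi⊆A → ⊂-irref refl (⊂-⊆-trans (proj₂ (Pf i)) fi⊆A)) e ,
  (λ { F.zero → colA ; (F.suc i) → colf i }) ,
  (λ { F.zero → PA ; (F.suc i) → proj₁ (Pf i) })

ListArrows : List Color → ℕ → ℕ → Set
ListArrows cs n N =
  (col : Coloring N) → Copy col cs ⊎ MonoCubeCopy n N col blue ⊎ MonoCubeCopy n N col red

arrows⇒listArrows : ∀ {t n N} {c : ColoredChain t} → Arrows c n N → ListArrows (tabulate c) n N
arrows⇒listArrows ar col = Sum.map₁ chainCopy⇒copy (ar col)

listArrows⇒arrows : ∀ {t n N} {c : ColoredChain t} → ListArrows (tabulate c) n N → Arrows c n N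
listArrows⇒arrows ar col =
  Sum.map₁ (λ cp → let f , e , colf , _ = chain⇒chainCopy cp in f , e , colf) (ar col)

copy-flip : ∀ {N} {col : Coloring N} {cs} → Copy (flipColor ∘ col) cs → Copy col (map flipColor cs)
copy-flip {col = col} (chain As s p w) = chain As s (unflip p) w
  where
  unflip : ∀ {As cs} → Pointwise (Painted (flipColor ∘ col)) As cs →
           Pointwise (Painted col) As (map flipColor cs)
  unflip []         = []
  unflip (colA ∷ p) = flipColor-swap colA ∷ unflip p

cube-flip : ∀ {n N} {col : Coloring N} {k} → MonoCubeCopy n N (flipColor ∘ col) k →
            MonoCubeCopy n N col (flipColor k)
cube-flip (g , e , colg) = g , e , flipColor-swap ∘ colg

listArrows-flip : ∀ {cs n N} → ListArrows cs n N → ListArrows (map flipColor cs) n N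
listArrows-flip ar col with ar (flipColor ∘ col)
... | inj₁ copy         = inj₁ (copy-flip copy)
... | inj₂ (inj₁ cube) = inj₂ (inj₂ (cube-flip {col = col} cube))
... | inj₂ (inj₂ cube) = inj₂ (inj₁ (cube-flip {col = col} cube))

listArrows-alternating : ∀ {a n N} k k′ → ListArrows (alternating k a) n N → ListArrows (alternating k′ a) n N
listArrows-alternating blue blue ar = ar
listArrows-alternating red  red  ar = ar
listArrows-alternating {a} {n} {N} blue red ar =
  subst (λ cs → ListArrows cs n N) (map-flipColor-alternating blue a) (listArrows-flip ar)
listArrows-alternating {a} {n} {N} red blue ar =
  subst (λ cs → ListArrows cs n N) (map-flipColor-alternating red a) (listArrows-flip ar)

-- Q_{N+1} consists of a lower and an upper copy of Q_N, told apart by the first coordinate. Send A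
-- to the upper copy iff the lower copy already contains the prefix xs, x below A ("A is early"); this
-- embeds Q_N into Q_{N+1}. In a copy of xs ++ x ∷ ys in the pulled-back colouring, the vertex A
-- playing x is early, since otherwise the prefix ending at A would lie in the lower copy. So a lower
-- copy of xs, x below A, followed by the upper images of A and of the chain above it, realises
-- xs ++ x ∷ x ∷ ys.

module Duplication {N : ℕ} (col : Coloring (suc N)) (xs : List Color) (x : Color) where

  Early : Subset N → Set
  Early A = Chain (col ∘ (outside ∷_)) (_⊆ A) (xs ++ [ x ])

  early? : ∀ A → Dec (Early A)
  early? A = chain? (_⊆? A) (xs ++ [ x ])

  early-mono : ∀ {A B} → A ⊆ B → Early A → Early B
  early-mono A⊆B = chain-weaken (λ X⊆A → ⊆-trans X⊆A A⊆B)

  lift : Subset N → Subset (suc N)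
  lift A = does (early? A) ∷ A

  lift-early : ∀ {A} → Early A → lift A ≡ inside ∷ A
  lift-early {A} eA with early? A
  ... | yes _  = refl
  ... | no ¬eA = ⊥-elim (¬eA eA)

  lift-late : ∀ {A} → ¬ Early A → lift A ≡ outside ∷ A
  lift-late {A} ¬eA with early? A
  ... | yes eA = ⊥-elim (¬eA eA)
  ... | no _   = refl

  lift-mono : ∀ {A B} → A ⊆ B → lift A ⊆ lift B
  lift-mono {A} {B} A⊆B with early? A | early? B
  ... | yes _  | yes _   = s⊆s A⊆B
  ... | no _   | _       = out⊆ A⊆B
  ... | yes eA | no ¬eB = ⊥-elim (¬eB (early-mono A⊆B eA))

  cube-lift : ∀ {n k} → MonoCubeCopy n N (col ∘ lift) k → MonoCubeCopy n (suc N) col k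
  cube-lift (g , e , colg) =
    lift ∘ g , (λ A B → lift-mono ∘ proj₁ (e A B) , proj₂ (e A B) ∘ drop-∷-⊆) , colg

  copy-lift : ∀ ys → Copy (col ∘ lift) (xs ++ x ∷ ys) → Copy col (xs ++ x ∷ x ∷ ys)
  copy-lift ys c with chain-split xs c
  ... | A , _ , colA , below , above = by-cases (early? A)
    where
    by-cases : Dec (Early A) → Copy col (xs ++ x ∷ x ∷ ys)
    by-cases (no ¬eA) = ⊥-elim (¬eA (chain-weaken proj₂ (chain-recolour
                          (λ (_ , X⊆A) → cong col (lift-late (¬eA ∘ early-mono X⊆A))) below)))
    by-cases (yes eA) = subst (Copy col) (++-assoc xs [ x ] (x ∷ ys)) (chain-++ cross lower upper)
      where
      lower : Chain col (_⊆ outside ∷ A) (xs ++ [ x ])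
      lower = chain-map (outside ∷_) s⊂s s⊆s eA
      upper : Chain col (inside ∷ A ⊆_) (x ∷ ys)
      upper = chain-map (inside ∷_) s⊂s s⊆s
                (chain-recolour (λ A⊆X → cong col (lift-early (early-mono A⊆X eA)))
                  (chain-∷⁺ (A , ⊆-refl , colA , chain-weaken (λ (_ , A⊂X) → proj₁ A⊂X , A⊂X) above)))
      cross : ∀ {X Y} → X ⊆ outside ∷ A → inside ∷ A ⊆ Y → X ⊂ Y
      cross X⊆ ⊆Y = ⊆-⊂-trans X⊆ (⊂-⊆-trans (out⊂in ⊆-refl) ⊆Y)

listArrows-duplicate : ∀ {n N} xs x ys → ListArrows (xs ++ x ∷ ys) n N →
                       ListArrows (xs ++ x ∷ x ∷ ys) n (suc N)
listArrows-duplicate xs x ys ar col =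
  Sum.map (copy-lift ys) (Sum.map cube-lift cube-lift) (ar (col ∘ lift))
  where open Duplication col xs x

data Inflation {A : Set} : ℕ → List A → List A → Set where
  stop   : ∀ {xs} → Inflation 0 xs xs
  double : ∀ {m ds} xs x ys → Inflation m ds (xs ++ x ∷ ys) → Inflation (suc m) ds (xs ++ x ∷ x ∷ ys)

inflation-∷ : ∀ {A : Set} {m ds cs} (k : A) → Inflation m ds cs → Inflation m (k ∷ ds) (k ∷ cs)
inflation-∷ k stop                = stop
inflation-∷ k (double xs x ys inf) = double (k ∷ xs) x ys (inflation-∷ k inf)

inflation⇒⊑ : ∀ {A : Set} {m} {ds cs : List A} → Inflation m ds cs → ds ⊑ cs
inflation⇒⊑ stop                 = ⊑-refl
inflation⇒⊑ (double xs x ys inf) = ⊑-trans (inflation⇒⊑ inf) (++⁺ ⊑-refl (refl ∷ (x ∷ʳ ⊑-refl)))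

listArrows-inflate : ∀ {m ds cs n N} → Inflation m ds cs → ListArrows ds n N → ListArrows cs n (m + N)
listArrows-inflate stop                 ar = ar
listArrows-inflate (double xs x ys inf) ar = listArrows-duplicate xs x ys (listArrows-inflate inf ar)

Skeleton : Color → List Color → ℕ → Set
Skeleton k ks r = Σ ℕ λ m → m + r ≡ length ks × Inflation m (alternating k (suc r)) (k ∷ ks)

skeleton-stutter : ∀ {k ks r} → Skeleton k ks r → Skeleton k (k ∷ ks) r
skeleton-stutter {k} {ks} (m , m+r≡ , inf) = suc m , cong suc m+r≡ , double [] k ks inf

skeleton-switch : ∀ {k ks r} → Skeleton (flipColor k) ks r → Skeleton k (flipColor k ∷ ks) (suc r)
skeleton-switch {k} {r = r} (m , m+r≡ , inf) = m , trans (+-suc m r) (cong suc m+r≡) , inflation-∷ k inf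

skeleton : ∀ k ks → Skeleton k ks (changes k ks)
skeleton k    []          = 0 , refl , stop
skeleton blue (blue ∷ ks) = skeleton-stutter (skeleton blue ks)
skeleton red  (red  ∷ ks) = skeleton-stutter (skeleton red ks)
skeleton blue (red  ∷ ks) = skeleton-switch (skeleton red ks)
skeleton red  (blue ∷ ks) = skeleton-switch (skeleton blue ks)

containsAlt⇒⊑ : ∀ {t a} {c : ColoredChain t} → ContainsAlt c a → ∃ λ k → alternating k a ⊑ tabulate c
containsAlt⇒⊑ (inj₁ (f , e , colf)) = red  , embedding⇒tabulate-⊑ f e colf
containsAlt⇒⊑ (inj₂ (f , e , colf)) = blue , embedding⇒tabulate-⊑ f e colf

⊑⇒containsAlt : ∀ {t a} {c : ColoredChain t} k → alternating k a ⊑ tabulate c → ContainsAlt c a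
⊑⇒containsAlt red  p = inj₁ (tabulate-⊑⇒embedding p)
⊑⇒containsAlt blue p = inj₂ (tabulate-⊑⇒embedding p)

blocks : ∀ {t} → ColoredChain (suc t) → ℕ
blocks c = suc (changes (c F.zero) (tabulate (c ∘ F.suc)))

containsAlt⇒≤blocks : ∀ {t a} {c : ColoredChain (suc t)} → ContainsAlt c a → a ≤ blocks c
containsAlt⇒≤blocks {c = c} contains with containsAlt⇒⊑ {c = c} contains
... | k , p = ≤-trans (alternating-⊑⇒≤changes p)
                      (+-monoˡ-≤ (changes (c F.zero) (tabulate (c ∘ F.suc)))
                                 (change≤1 (flipColor k) (c F.zero)))

isAlpha⇒≡blocks : ∀ {t α} {c : ColoredChain (suc t)} → IsAlpha c α → α ≡ blocks c
isAlpha⇒≡blocks {c = c} (contains , maximal) =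
  ≤-antisym (containsAlt⇒≤blocks {c = c} contains) (maximal (blocks c) blocks-alternate)
  where
  blocks-alternate : ContainsAlt c (blocks c)
  blocks-alternate with skeleton (c F.zero) (tabulate (c ∘ F.suc))
  ... | _ , _ , inf = ⊑⇒containsAlt {c = c} (c F.zero) (inflation⇒⊑ inf)

subchain-arrows : ∀ {a t n N} {d : ColoredChain a} {c : ColoredChain t} →
                  ChainInChain d c → Arrows c n N → Arrows d n N
subchain-arrows (g , eg , colg) ar col =
  Sum.map₁ (λ (f , ef , colf) → f ∘ g , embedding-∘ {_≼_ = _⊆_} eg ef , λ i → trans (colf (g i)) (colg i))
           (ar col)

alternating-arrows : ∀ {t α n N} {c : ColoredChain t} →
                     ContainsAlt c α → Arrows c n N → Arrows (rbr α) n N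
alternating-arrows (inj₁ emb) ar = subchain-arrows emb ar
alternating-arrows {α = α} (inj₂ emb) ar =
  listArrows⇒arrows {c = rbr α}
    (listArrows-alternating blue red (arrows⇒listArrows (subchain-arrows emb ar)))

arrows-from-alternating : ∀ {t α n N} {c : ColoredChain t} → IsAlpha c α →
                          Arrows (rbr α) n N → Arrows c n (N + (t ∸ α))
arrows-from-alternating {zero} _ _ col = inj₁ ((λ ()) , (λ ()) , (λ ()))
arrows-from-alternating {suc t} {n = n} {N} {c} isα ar
  with skeleton (c F.zero) (tabulate (c ∘ F.suc)) | isAlpha⇒≡blocks {c = c} isα
... | m , m+r≡ , inf | refl =
  subst (Arrows c n) m+N≡ (listArrows⇒arrows {c = c} (listArrows-inflate inf
    (listArrows-alternating red (c F.zero) (arrows⇒listArrows ar))))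
  where
  r = changes (c F.zero) (tabulate (c ∘ F.suc))
  m≡ : m ≡ t ∸ r
  m≡ = trans (sym (m+n∸n≡m m r)) (cong (_∸ r) (trans m+r≡ (length-tabulate (c ∘ F.suc))))
  m+N≡ : m + N ≡ N + (t ∸ r)
  m+N≡ = trans (+-comm m N) (cong (N +_) m≡)

theorem4 : (n t : ℕ) (c : ColoredChain t) (α : ℕ) → IsAlpha c α →
    (R₁ R₂ : ℕ) → IsRamsey (rbr α) n R₁ → IsRamsey c n R₂ →
    R₁ ≤ R₂ × R₂ ≤ R₁ + (t ∸ α)
theorem4 n t c α isα R₁ R₂ (arrows₁ , minimal₁) (arrows₂ , minimal₂) =
  minimal₁ R₂ (alternating-arrows (proj₁ isα) arrows₂) ,
  minimal₂ (R₁ + (t ∸ α)) (arrows-from-alternating isα arrows₁)
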